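{- For every rooted undirected graph $(G,d)$ with $G=(D,R)$, Player I has a winning strategy in the undirected edge geography game on $(G,d)$ if and only if $M_G,d\models\phi_G$.
   Context: An undirected graph $G=(D,R)$ has $D$ a finite nonempty set and $R$ a set of two-element subsets of $D$; $(G,d)$ with $d\in D$ is a rooted undirected graph. Undirected edge geography (UEG) on $(G,d)$: the player to move must choose an edge $\{d,d'\}\in R$; if none exists, that player loses. Otherwise the opponent becomes the player to move in the game on $(G',d')$ with $G'=(D,R\setminus\{\{d,d'\}\})$. Player I moves first. Logic: fix countably infinite sets $\mathsf{P}$ (atoms), $\mathsf{A}$ (agents), $\mathsf{S}$ (skills). A model is $M=(W,E,C,\beta)$ with $W\ne\emptyset$, $E:W\times W\to\wp(\mathsf{S})$ symmetric with $E(w,u)=\mathsf{S}$ only if $w=u$, $C:\mathsf{A}\to\wp(\mathsf{S})$, $\beta:W\to\wp(\mathsf{P})$. Satisfaction: $p$ iff $p\in\beta(w)$; Booleans as usual; $M,w\models K_a\psi$ iff $M,u\models\psi$ for all $u$ with $C(a)\subseteq E(w,u)$; $M,w\models\boxplus_a\psi$ iff for every finite nonempty $S\subseteq\mathsf{S}$, $(W,E,C^{a+S},\beta),w\models\psi$, where $C^{a+S}(a)=C(a)\cup S$ and $C^{a+S}(x)=C(x)$ for $x\ne a$. Abbreviations: $\hat K_a\psi:=\neg K_a\neg\psi$, $\langle\boxplus\rangle_a\psi:=\neg\boxplus_a\neg\psi$, $\bot:=\neg(p\to p)$; an empty disjunction is $\bot$. Induced model: assign to each edge $\{x,y\}\in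 R$ a skill $s_{\{x,y\}}\in\mathsf{S}$ (distinct edges get distinct skills) and to each $x\in D$ an atom $p_x$ (distinct nodes get distinct atoms). $M_G=(D,E,C,\beta)$ with $E(x,y)=\{s_{\{x,y\}}\}$ if $\{x,y\}\in R$ and $E(x,y)=\emptyset$ otherwise, $C(a)=\emptyset$ for every agent $a$, and $\beta(x)=\{p_x\}$. Induced formula: let $n$ be the smallest positive even integer with $n\ge|R|$, and $a_1,\dots,a_n$ distinct agents. For $1\le i\le n$ let $\psi_i:=\neg K_{a_i}\bot\wedge\bigvee_{x\in D}K_{a_i}p_x$ and $\chi_i:=\bigvee_{x,y\in D,\,x\ne y,\,1\le j<i}(p_x\wedge\hat K_{a_j}p_y\wedge K_{a_i}p_y)$. For odd $i$ define $\Theta_{n-1}:=\langle\boxplus\rangle_{a_{n-1}}(\psi_{n-1}\wedge\neg\chi_{n-1}\wedge K_{a_{n-1}}\boxplus_{a_n}(\neg\psi_n\vee\chi_n))$ and, for odd $i<n-1$, $\Theta_i:=\langle\boxplus\rangle_{a_i}(\psi_i\wedge\neg\chi_i\wedge K_{a_i}\boxplus_{a_{i+1}}(\neg\psi_{i+1}\vee\chi_{i+1}\vee\hat K_{a_{i+1}}\Theta_{i+2}))$. The induced formula is $\phi_G:=\Theta_1$. -}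

module Defs where

open import Data.Nat using (ℕ; zero; suc; _+_; _*_; _∸_; _≤_; _⊔_; _<ᵇ_; ⌊_/2⌋)
import Data.Nat as ℕ
open import Data.Fin using (Fin; toℕ)
import Data.Fin as F
open import Data.Bool using (Bool; true; false; _∧_; _∨_; not; if_then_else_)
open import Data.Nat.ListAction using (sum)
open import Data.List using (List; []; _∷_; map; allFin; concatMap; foldr; upTo)
open import Data.List.Membership.Propositional using (_∈_)
open import Data.Product using (_×_; _,_; proj₁; proj₂)
open import Data.Sum using (_⊎_; inj₁; inj₂)
open import Data.Empty using (⊥; ⊥-elim)
open import Relation.Nullary using (¬_; does)
open import Relation.Binary.PropositionalEquality using (_≡_; _≢_; refl; sym; trans; cong; subst)

-- Undirected graphs on the finite nonempty node set D = Fin k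
-- (nonemptiness is witnessed by the root d : Fin k).
-- The edge set R (a set of two-element subsets of D) is given by its
-- characteristic function: adj x y = true iff {x,y} ∈ R.

record Graph (k : ℕ) : Set where
  field
    adj    : Fin k → Fin k → Bool
    adj-sym    : ∀ x y → adj x y ≡ adj y x
    adj-irrefl : ∀ x → adj x x ≡ false
open Graph public

_==_ : ∀ {k} → Fin k → Fin k → Bool
x == y = does (x F.≟ y)

removeEdge : ∀ {k} → (Fin k → Fin k → Bool) → Fin k → Fin k → (Fin k → Fin k → Bool)
removeEdge r d d' x y = r x y ∧ not ((x == d ∧ y == d') ∨ (x == d' ∧ y == d))

-- Undirected edge geography: `Wins r d` = the player to move in the game on
-- ((D, r), d) has a winning strategy; `Loses r d` = the player to move
-- has no winning strategy, i.e. the opponent has one (the game is finite,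
-- so winning strategies are exactly the well-founded trees below).
mutual
  data Wins {k : ℕ} (r : Fin k → Fin k → Bool) (d : Fin k) : Set where
    move : (d' : Fin k) → r d d' ≡ true → Loses (removeEdge r d d') d' → Wins r d

  data Loses {k : ℕ} (r : Fin k → Fin k → Bool) (d : Fin k) : Set where
    stuck : (∀ d' → r d d' ≡ true → Wins (removeEdge r d d') d') → Loses r d

PlayerIWins : ∀ {k} → Graph k → Fin k → Set
PlayerIWins G d = Wins (adj G) d

edgeCount : ∀ {k} → Graph k → ℕ
edgeCount {k} G =
  sum (map (λ x → sum (map (λ y → if adj G x y ∧ (toℕ x <ᵇ toℕ y) then 1 else 0) (allFin k))) (allFin k))

evenCeil : ℕ → ℕ
evenCeil zero = zero
evenCeil (suc zero) = 2
evenCeil (suc (suc m)) = 2 + evenCeil m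

posEvenCeil : ℕ → ℕ
posEvenCeil m = 2 ⊔ evenCeil m

-- Logic.  Atoms P, agents A, skills S are all ℕ (countably infinite).
-- Sets of skills ℘(S) are predicates ℕ → Set.

data Form : Set where
  atom : ℕ → Form
  ¬'_  : Form → Form
  _∧'_ : Form → Form → Form
  _∨'_ : Form → Form → Form
  _⇒'_ : Form → Form → Form
  K    : ℕ → Form → Form
  ⊞    : ℕ → Form → Form

infixr 6 _∧'_
infixr 5 _∨'_
infixr 4 _⇒'_

K̂ : ℕ → Form → Form
K̂ a ψ = ¬' K a (¬' ψ)

⟨⊞⟩ : ℕ → Form → Form
⟨⊞⟩ a ψ = ¬' ⊞ a (¬' ψ)

⊥' : Form
⊥' = ¬' (atom 0 ⇒' atom 0)

⋁ : List Form → Form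
⋁ = foldr _∨'_ ⊥'

SkillSet : Set₁
SkillSet = ℕ → Set

record Model : Set₁ where
  field
    W  : Set
    w₀ : W                                  -- W ≠ ∅
    E  : W → W → SkillSet
    C  : ℕ → SkillSet
    β  : W → ℕ → Set
    E-sym  : ∀ w u s → E w u s → E u w s
    E-full : ∀ w u → (∀ s → E w u s) → w ≡ u
open Model public

addSkills : (ℕ → SkillSet) → ℕ → List ℕ → (ℕ → SkillSet)
addSkills c a S b s = if does (b ℕ.≟ a) then (c b s ⊎ s ∈ S) else c b s

_⊆ˢ_ : SkillSet → SkillSet → Set
X ⊆ˢ Y = ∀ s → X s → Y s

_,_⊨_ : (M : Model) → W M → Form → Set
M , w ⊨ atom p   = β M w p
M , w ⊨ (¬' φ)   = ¬ (M , w ⊨ φ)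
M , w ⊨ (φ ∧' ψ) = (M , w ⊨ φ) × (M , w ⊨ ψ)
M , w ⊨ (φ ∨' ψ) = (M , w ⊨ φ) ⊎ (M , w ⊨ ψ)
M , w ⊨ (φ ⇒' ψ) = (M , w ⊨ φ) → (M , w ⊨ ψ)
M , w ⊨ K a φ    = ∀ u → C M a ⊆ˢ E M w u → M , u ⊨ φ
M , w ⊨ ⊞ a φ    = ∀ (S : List ℕ) → S ≢ [] →
                     record M { C = addSkills (C M) a S } , w ⊨ φ

record SkillAssignment {k : ℕ} (G : Graph k) : Set where
  field
    skill     : Fin k → Fin k → ℕ      -- skill x y = s_{{x,y}} for {x,y} ∈ R
    skill-sym : ∀ x y → adj G x y ≡ true → skill x y ≡ skill y x
    skill-inj : ∀ x y u v → adj G x y ≡ true → adj G u v ≡ true →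
                skill x y ≡ skill u v → (x ≡ u × y ≡ v) ⊎ (x ≡ v × y ≡ u)
open SkillAssignment public

record AtomAssignment (k : ℕ) : Set where
  field
    atomOf     : Fin k → ℕ
    atomOf-inj : ∀ x y → atomOf x ≡ atomOf y → x ≡ y
open AtomAssignment public

private
  n≢1+n : ∀ n → n ≢ suc n
  n≢1+n zero ()
  n≢1+n (suc n) eq = n≢1+n n (cong ℕ.pred eq)

M_G : ∀ {k} (G : Graph k) → Fin k → SkillAssignment G → AtomAssignment k → Model
M_G {k} G d sk at = record
  { W = Fin k
  ; w₀ = d
  ; E = λ x y s → (adj G x y ≡ true) × (s ≡ skill sk x y)
  ; C = λ a s → ⊥
  ; β = λ x p → p ≡ atomOf at x
  ; E-sym = λ x y s e → trans (adj-sym G y x) (proj₁ e) ,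
                        trans (proj₂ e) (skill-sym sk x y (proj₁ e))
  ; E-full = λ x y f → ⊥-elim (n≢1+n (skill sk x y)
                 (sym (proj₂ (f (suc (skill sk x y))))))
  }

record AgentAssignment (n : ℕ) : Set where
  field
    agent     : ℕ → ℕ
    agent-inj : ∀ i j → 1 ≤ i → i ≤ n → 1 ≤ j → j ≤ n → agent i ≡ agent j → i ≡ j
open AgentAssignment public

nG : ∀ {k} → Graph k → ℕ
nG G = posEvenCeil (edgeCount G)

module Induced {k : ℕ} (G : Graph k) (at : AtomAssignment k) (ag : AgentAssignment (nG G)) where
  n : ℕ
  n = nG G

  a : ℕ → ℕ
  a = agent ag

  p : Fin k → Form
  p x = atom (atomOf at x)

  ψ : ℕ → Form
  ψ i = ¬' K (a i) ⊥' ∧' ⋁ (map (λ x → K (a i) (p x)) (allFin k))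

  χ : ℕ → Form
  χ i = ⋁ (concatMap (λ x → concatMap (λ y →
          if x == y then [] else
            map (λ j → p x ∧' K̂ (a j) (p y) ∧' K (a i) (p y))
                (map suc (upTo (i ∸ 1))))   -- j = 1, …, i-1
          (allFin k)) (allFin k))

  -- Θ_{n-1} (to be used with i = n-1)
  Θbase : ℕ → Form
  Θbase i = ⟨⊞⟩ (a i) (ψ i ∧' ¬' χ i ∧'
              K (a i) (⊞ (a (suc i)) (¬' ψ (suc i) ∨' χ (suc i))))

  -- Θ_i for odd i < n-1, given Θ_{i+2}
  Θstep : ℕ → Form → Form
  Θstep i next = ⟨⊞⟩ (a i) (ψ i ∧' ¬' χ i ∧'
              K (a i) (⊞ (a (suc i)) (¬' ψ (suc i) ∨' χ (suc i) ∨' K̂ (a (suc i)) next)))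

  -- Θaux t i = Θ_i where i = n - 1 - 2t
  Θaux : ℕ → ℕ → Form
  Θaux zero    i = Θbase i
  Θaux (suc t) i = Θstep i (Θaux t (2 + i))

  -- φ_G = Θ_1  (1 = n - 1 - 2·((n-2)/2), n even ≥ 2)
  φ : Form
  φ = Θaux ⌊ (n ∸ 2) /2⌋ 1

φ_G : ∀ {k} (G : Graph k) → AtomAssignment k → AgentAssignment (nG G) → Form
φ_G G at ag = Induced.φ G at ag

module Submission where

-- In the induced model every agent starts without skills. Giving agent a a nonempty skill set S
-- makes K_a range over the nodes u with S ⊆ E(w,u), and as edges carry distinct skills there is at
-- most one such u. So ⟨⊞⟩_{a_i} chooses a move w → u of Player I (ψ_i: the choice is an edge),
-- ⊞_{a_{i+1}} ranges over the replies of Player II, and χ_i says that the chosen edge was played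
-- before, because an earlier agent a_j still singles it out. By induction on the number of rounds
-- left, with an invariant tying the skills of a_1, …, a_{i-1} to the edges already played, a
-- winning position satisfies Θ_i and a losing one refutes it; the game is determined, which gives
-- the converse. Since n ≥ |R|, every winning play of Player I ends within the n/2 rounds of Θ_1.

open import Defs
open import Data.Nat using (ℕ; zero; suc; _+_; _∸_; _≤_; _<_; z≤n; s≤s; _<ᵇ_; ⌊_/2⌋)
import Data.Nat as ℕ
open import Data.Nat.Properties
  using (≤-refl; ≤-trans; ≤-pred; <⇒≤; <-≤-trans; ≤-<-trans; <-irrefl; ≤⇒≯; n≮0; n<1+n;
         m<n⇒m<1+n; m<1+n⇒m<n∨m≡n; m+n≤o⇒m≤o; +-suc; +-mono-≤; +-mono-<-≤; +-mono-≤-<;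
         +-monoʳ-≤; m≤n⊔m; ≤-reflexive; <-cmp; <⇒<ᵇ)
open import Data.Nat.ListAction using (sum)
open import Data.Fin using (Fin; toℕ)
import Data.Fin as F
open import Data.Fin.Properties using (toℕ-injective; any?)
open import Data.Bool using (Bool; true; false; _∧_; not; if_then_else_; T)
import Data.Bool as Bool
open import Data.Bool.Properties using (∧-zeroʳ; ∧-identityʳ; ∧-conicalˡ)
open import Data.List using (List; []; _∷_; [_]; map; allFin; concatMap; upTo)
open import Data.List.Membership.Propositional using (_∈_; find; lose)
open import Data.List.Membership.Propositional.Properties using (∈-allFin; ∈-upTo⁺; ∈-upTo⁻)
open import Data.List.Relation.Unary.Any using (Any; here; there; satisfied)
open import Data.List.Relation.Unary.Any.Properties using (map⁺; map⁻; concatMap⁺; concatMap⁻)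
import Data.List.Relation.Unary.All as All
open import Data.Product using (∃; _×_; _,_; proj₁; proj₂)
open import Data.Sum using (_⊎_; inj₁; inj₂; [_,_]′; map₂)
open import Data.Empty using (⊥)
open import Function using (_∘_; id; case_of_)
open import Function.Bundles using (_⇔_; mk⇔)
open import Relation.Nullary using (¬_; Dec; yes; no; does; contradiction; _×-dec_; _⊎-dec_)
open import Relation.Nullary.Decidable using (dec-true; dec-false; map′)
open import Relation.Binary using (tri<; tri≈; tri>)
open import Relation.Binary.PropositionalEquality
  using (_≡_; _≢_; refl; sym; trans; cong; subst; ≢-sym; module ≡-Reasoning)

Any-unless⁺ : ∀ {A : Set} {P : A → Set} {b xs} → b ≡ false → Any P xs → Any P (if b then [] else xs)
Any-unless⁺ refl = id

Any-unless⁻ : ∀ {A : Set} {P : A → Set} {xs} b → Any P (if b then [] else xs) → Any P xs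
Any-unless⁻ false = id
Any-unless⁻ true  ()

≢[]⇒∃∈ : ∀ {A : Set} {xs : List A} → xs ≢ [] → ∃ λ x → x ∈ xs
≢[]⇒∃∈ {xs = []}    xs≢[] = contradiction refl xs≢[]
≢[]⇒∃∈ {xs = x ∷ _} _     = x , here refl

⊨⋁⁻ : ∀ {M w} (φs : List Form) → M , w ⊨ ⋁ φs → Any (M , w ⊨_) φs
⊨⋁⁻ []       ⊨⊥         = contradiction id ⊨⊥
⊨⋁⁻ (φ ∷ φs) (inj₁ ⊨φ)  = here ⊨φ
⊨⋁⁻ (φ ∷ φs) (inj₂ ⊨φs) = there (⊨⋁⁻ φs ⊨φs)

⊨⋁⁺ : ∀ {M w} {φs : List Form} → Any (M , w ⊨_) φs → M , w ⊨ ⋁ φs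
⊨⋁⁺ (here ⊨φ)   = inj₁ ⊨φ
⊨⋁⁺ (there ⊨φs) = inj₂ (⊨⋁⁺ ⊨φs)

module _ {c : ℕ → SkillSet} {b : ℕ} {S : List ℕ} {s : ℕ} where

  addSkills-self⁻ : addSkills c b S b s → c b s ⊎ s ∈ S
  addSkills-self⁻ = subst (λ t → if t then c b s ⊎ s ∈ S else c b s) (dec-true (b ℕ.≟ b) refl)

  addSkills-self⁺ : c b s ⊎ s ∈ S → addSkills c b S b s
  addSkills-self⁺ = subst (λ t → if t then c b s ⊎ s ∈ S else c b s) (sym (dec-true (b ℕ.≟ b) refl))

  module _ {b′ : ℕ} (b′≢b : b′ ≢ b) where

    addSkills-other⁻ : addSkills c b S b′ s → c b′ s
    addSkills-other⁻ = subst (λ t → if t then c b′ s ⊎ s ∈ S else c b′ s) (dec-false (b′ ℕ.≟ b) b′≢b)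

    addSkills-other⁺ : c b′ s → addSkills c b S b′ s
    addSkills-other⁺ = subst (λ t → if t then c b′ s ⊎ s ∈ S else c b′ s) (sym (dec-false (b′ ℕ.≟ b) b′≢b))

Edges : ℕ → Set
Edges k = Fin k → Fin k → Bool

module _ {k : ℕ} where

  SameEdge : Fin k → Fin k → Fin k → Fin k → Set
  SameEdge w u x y = (x ≡ w × y ≡ u) ⊎ (x ≡ u × y ≡ w)

  -- Its Boolean is literally the one that removeEdge negates.
  sameEdge? : ∀ w u x y → Dec (SameEdge w u x y)
  sameEdge? w u x y = (x F.≟ w ×-dec y F.≟ u) ⊎-dec (x F.≟ u ×-dec y F.≟ w)

  SameEdge-swap : ∀ {w u x y} → SameEdge w u x y → SameEdge w u y x
  SameEdge-swap (inj₁ (x≡w , y≡u)) = inj₂ (y≡u , x≡w)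
  SameEdge-swap (inj₂ (x≡u , y≡w)) = inj₁ (y≡w , x≡u)

  module _ {r : Edges k} {w u x y : Fin k} where

    removeEdge-removed : SameEdge w u x y → removeEdge r w u x y ≡ false
    removeEdge-removed same = begin
      r x y ∧ not (does (sameEdge? w u x y)) ≡⟨ cong (λ t → r x y ∧ not t) (dec-true (sameEdge? w u x y) same) ⟩
      r x y ∧ false                          ≡⟨ ∧-zeroʳ (r x y) ⟩
      false                                  ∎
      where open ≡-Reasoning

    removeEdge-kept : ¬ SameEdge w u x y → removeEdge r w u x y ≡ r x y
    removeEdge-kept other = begin
      r x y ∧ not (does (sameEdge? w u x y)) ≡⟨ cong (λ t → r x y ∧ not t) (dec-false (sameEdge? w u x y) other) ⟩
      r x y ∧ true                           ≡⟨ ∧-identityʳ (r x y) ⟩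
      r x y                                  ∎
      where open ≡-Reasoning

    removeEdge-⊆ : removeEdge r w u x y ≡ true → r x y ≡ true
    removeEdge-⊆ = ∧-conicalˡ (r x y) _

    removeEdge-absent : r x y ≡ false → removeEdge r w u x y ≡ false
    removeEdge-absent rxy = cong (λ t → t ∧ _) rxy

    removeEdge-false : removeEdge r w u x y ≡ false → r x y ≡ false ⊎ SameEdge w u x y
    removeEdge-false r′xy with sameEdge? w u x y
    ... | yes same = inj₂ same
    ... | no other = inj₁ (trans (sym (removeEdge-kept other)) r′xy)

  record Simple (r : Edges k) : Set where
    field
      symmetric   : ∀ x y → r x y ≡ r y x
      irreflexive : ∀ x → r x x ≡ false

  removeEdge-simple : ∀ {r w u} → Simple r → Simple (removeEdge r w u)
  removeEdge-simple {r} {w} {u} s = record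
    { symmetric   = removeEdge-sym
    ; irreflexive = λ x → removeEdge-absent {r = r} {w} {u} (Simple.irreflexive s x)
    }
    where
    removeEdge-sym : ∀ x y → removeEdge r w u x y ≡ removeEdge r w u y x
    removeEdge-sym x y with sameEdge? w u x y
    ... | yes same = trans (removeEdge-removed {r = r} same) (sym (removeEdge-removed {r = r} (SameEdge-swap same)))
    ... | no other = begin
      removeEdge r w u x y ≡⟨ removeEdge-kept {r = r} other ⟩
      r x y                ≡⟨ Simple.symmetric s x y ⟩
      r y x                ≡⟨ sym (removeEdge-kept {r = r} (other ∘ SameEdge-swap)) ⟩
      removeEdge r w u y x ∎
      where open ≡-Reasoning

  -- edgeCount G is edges (adj G) by definition.
  edges : Edges k → ℕ
  edges r = sum (map (λ x → sum (map (λ y → if r x y ∧ (toℕ x <ᵇ toℕ y) then 1 else 0) (allFin k))) (allFin k))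

sum-map-mono : ∀ {A : Set} {f g : A → ℕ} xs → (∀ x → f x ≤ g x) → sum (map f xs) ≤ sum (map g xs)
sum-map-mono []       f≤g = z≤n
sum-map-mono (x ∷ xs) f≤g = +-mono-≤ (f≤g x) (sum-map-mono xs f≤g)

sum-map-mono-< : ∀ {A : Set} {f g : A → ℕ} {x} xs → x ∈ xs → (∀ x → f x ≤ g x) → f x < g x →
                 sum (map f xs) < sum (map g xs)
sum-map-mono-< (y ∷ xs) (here refl) f≤g fx<gx = +-mono-<-≤ fx<gx (sum-map-mono xs f≤g)
sum-map-mono-< (y ∷ xs) (there x∈) f≤g fx<gx = +-mono-≤-< (f≤g y) (sum-map-mono-< xs x∈ f≤g fx<gx)

indicator-mono : ∀ b b′ c → (b ≡ true → b′ ≡ true) → (if b ∧ c then 1 else 0) ≤ (if b′ ∧ c then 1 else 0)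
indicator-mono false b′   c b⇒b′ = z≤n
indicator-mono true  b′   c b⇒b′ with refl ← b⇒b′ refl = ≤-refl

indicator-mono-< : ∀ {b b′ c} → b ≡ false → b′ ≡ true → T c → (if b ∧ c then 1 else 0) < (if b′ ∧ c then 1 else 0)
indicator-mono-< {c = true} refl refl _ = s≤s z≤n

module _ {k : ℕ} where

  edges-mono-< : ∀ {r′ r : Edges k} {x y} → (∀ x y → r′ x y ≡ true → r x y ≡ true) →
                 r′ x y ≡ false → r x y ≡ true → toℕ x < toℕ y → edges r′ < edges r
  edges-mono-< {r′} {r} {x} {y} r′⊆r r′xy rxy x<y =
    sum-map-mono-< (allFin k) (∈-allFin x)
      (λ x′ → sum-map-mono (allFin k) (λ y′ → indicator-mono (r′ x′ y′) (r x′ y′) _ (r′⊆r x′ y′)))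
      (sum-map-mono-< (allFin k) (∈-allFin y)
        (λ y′ → indicator-mono (r′ x y′) (r x y′) _ (r′⊆r x y′))
        (indicator-mono-< r′xy rxy (<⇒<ᵇ x<y)))

  edges-removeEdge-< : ∀ {r : Edges k} {x y} → Simple r → r x y ≡ true → edges (removeEdge r x y) < edges r
  edges-removeEdge-< {r} {x} {y} s rxy with <-cmp (toℕ x) (toℕ y)
  ... | tri< x<y _ _ = edges-mono-< (λ _ _ → removeEdge-⊆ {r = r}) (removeEdge-removed {r = r} {x} {y} (inj₁ (refl , refl))) rxy x<y
  ... | tri≈ _ x≡y _ with refl ← toℕ-injective x≡y = contradiction (trans (sym rxy) (Simple.irreflexive s x)) λ ()
  ... | tri> _ _ y<x = edges-mono-< (λ _ _ → removeEdge-⊆ {r = r}) (removeEdge-removed {r = r} {x} {y} (inj₂ (refl , refl)))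
                                    (trans (Simple.symmetric s y x) rxy) y<x

  edges-two-moves : ∀ {r : Edges k} {w u v} → Simple r → r w u ≡ true → removeEdge r w u u v ≡ true →
                    2 + edges (removeEdge (removeEdge r w u) u v) ≤ edges r
  edges-two-moves s rwu r′uv =
    ≤-trans (s≤s (edges-removeEdge-< (removeEdge-simple s) r′uv)) (edges-removeEdge-< s rwu)

  wins⇒edges>0 : ∀ {r : Edges k} {w} → Simple r → Wins r w → 0 < edges r
  wins⇒edges>0 s (move u rwu _) = ≤-<-trans z≤n (edges-removeEdge-< s rwu)

  no-third-move : ∀ {r : Edges k} {w u v} → Simple r → r w u ≡ true → removeEdge r w u u v ≡ true →
                  edges r ≤ 2 → ¬ Wins (removeEdge (removeEdge r w u) u v) v
  no-third-move s rwu r′uv edges≤2 wins =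
    ≤⇒≯ edges≤2 (≤-trans (+-monoʳ-≤ 2 (wins⇒edges>0 (removeEdge-simple (removeEdge-simple s)) wins))
                         (edges-two-moves s rwu r′uv))

  wins⇒¬loses : ∀ {r : Edges k} {w} → Wins r w → ¬ Loses r w
  wins⇒¬loses (move u rwu loses) (stuck replies) = wins⇒¬loses (replies u rwu) loses

  determined : ∀ N {r : Edges k} → Simple r → edges r ≤ N → ∀ w → Wins r w ⊎ Loses r w
  determined zero s bound w =
    inj₂ (stuck λ u rwu → contradiction (<-≤-trans (edges-removeEdge-< s rwu) bound) n≮0)
  determined (suc N) {r} s bound w = decide (any? winning?)
    where
    subgame : ∀ u → r w u ≡ true → Wins (removeEdge r w u) u ⊎ Loses (removeEdge r w u) u
    subgame u rwu = determined N (removeEdge-simple s) (≤-pred (<-≤-trans (edges-removeEdge-< s rwu) bound)) u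

    winning? : ∀ u → Dec (r w u ≡ true × Loses (removeEdge r w u) u)
    winning? u with r w u Bool.≟ true
    ... | no ¬rwu = no (¬rwu ∘ proj₁)
    ... | yes rwu with subgame u rwu
    ...   | inj₁ wins  = no (wins⇒¬loses wins ∘ proj₂)
    ...   | inj₂ loses = yes (rwu , loses)

    decide : Dec (∃ λ u → r w u ≡ true × Loses (removeEdge r w u) u) → Wins r w ⊎ Loses r w
    decide (yes (u , rwu , loses)) = inj₁ (move u rwu loses)
    decide (no noWinningMove)      = inj₂ (stuck λ u rwu →
      [ id , (λ loses → contradiction (u , rwu , loses) noWinningMove) ]′ (subgame u rwu))

double : ℕ → ℕ
double zero    = zero
double (suc t) = suc (suc (double t))

⌊double/2⌋ : ∀ t → ⌊ double t /2⌋ ≡ t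
⌊double/2⌋ zero    = refl
⌊double/2⌋ (suc t) = cong suc (⌊double/2⌋ t)

evenCeil-double : ∀ m → ∃ λ t → evenCeil m ≡ double t
evenCeil-double zero          = 0 , refl
evenCeil-double (suc zero)    = 1 , refl
evenCeil-double (suc (suc m)) = let t , eq = evenCeil-double m in suc t , cong (suc ∘ suc) eq

≤evenCeil : ∀ m → m ≤ evenCeil m
≤evenCeil zero          = z≤n
≤evenCeil (suc zero)    = s≤s z≤n
≤evenCeil (suc (suc m)) = s≤s (s≤s (≤evenCeil m))

≤posEvenCeil : ∀ m → m ≤ posEvenCeil m
≤posEvenCeil m = ≤-trans (≤evenCeil m) (m≤n⊔m 2 (evenCeil m))

posEvenCeil≡double : ∀ m → posEvenCeil m ≡ double (suc ⌊ (posEvenCeil m ∸ 2) /2⌋)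
posEvenCeil≡double m with evenCeil-double m
... | zero  , eq rewrite eq = refl
... | suc t , eq rewrite eq = cong (double ∘ suc) (sym (⌊double/2⌋ t))

<∸1⇒suc< : ∀ {j} i → j < i ∸ 1 → suc j < i
<∸1⇒suc< (suc i) j<i = s≤s j<i

round-bounds : ∀ {i t n} → i + double (suc t) < n → suc i < n × suc (suc i) + double t < n
round-bounds {i} {t} {n} bound = <⇒≤ (m+n≤o⇒m≤o (3 + i) next) , next
  where
  next : suc (suc i) + double t < n
  next = subst (_< n) (trans (+-suc i (suc (double t))) (cong suc (+-suc i (double t)))) bound

module Play {k : ℕ} (G : Graph k) (d : Fin k) (sk : SkillAssignment G) (at : AtomAssignment k)
            (ag : AgentAssignment (nG G)) where

  open Induced G at ag

  M₀ : Model
  M₀ = M_G G d sk at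

  M[_] : (ℕ → SkillSet) → Model
  M[ c ] = record M₀ { C = c }

  Accessible : List ℕ → Fin k → Fin k → Set
  Accessible S w u = (_∈ S) ⊆ˢ E M₀ w u

  Fresh : (ℕ → SkillSet) → ℕ → Set
  Fresh c b = ∀ s → ¬ c b s

  adj-simple : Simple (adj G)
  adj-simple = record { symmetric = adj-sym G ; irreflexive = adj-irrefl G }

  adj⇒≢ : ∀ {x y} → adj G x y ≡ true → x ≢ y
  adj⇒≢ {x} axy refl = contradiction (trans (sym axy) (adj-irrefl G x)) λ ()

  E-same : ∀ {w u x y s} → SameEdge w u x y → E M₀ w u s → E M₀ x y s
  E-same (inj₁ (refl , refl)) e = e
  E-same (inj₂ (refl , refl)) e = E-sym M₀ _ _ _ e

  E-skill-injective : ∀ {w u x y s} → E M₀ x y s → E M₀ w u s → SameEdge w u x y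
  E-skill-injective (axy , s≡sxy) (awu , s≡swu) = skill-inj sk _ _ _ _ axy awu (trans (sym s≡sxy) s≡swu)

  single-accessible : ∀ {w u} → adj G w u ≡ true → Accessible [ skill sk w u ] w u
  single-accessible awu s (here refl) = awu , refl

  accessible? : ∀ S w u → Dec (Accessible S w u)
  accessible? S w u =
    map′ (λ all s → All.lookup all) (λ acc → All.tabulate (acc _))
         (All.all? (λ s → (adj G w u Bool.≟ true) ×-dec (s ℕ.≟ skill sk w u)) S)

  accessible⇒adj : ∀ {S w u} → S ≢ [] → Accessible S w u → adj G w u ≡ true
  accessible⇒adj S≢[] acc = let s , s∈S = ≢[]⇒∃∈ S≢[] in proj₁ (acc s s∈S)

  accessible-unique : ∀ {S w u u′} → S ≢ [] → Accessible S w u → Accessible S w u′ → u ≡ u′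
  accessible-unique S≢[] acc acc′ with s , s∈S ← ≢[]⇒∃∈ S≢[]
                                   with E-skill-injective (acc′ s s∈S) (acc s s∈S)
  ... | inj₁ (_ , u′≡u) = sym u′≡u
  ... | inj₂ (w≡u , _)  = contradiction w≡u (adj⇒≢ (proj₁ (acc s s∈S)))

  added⊆E : ∀ {c b S w u} → Fresh c b → Accessible S w u → addSkills c b S b ⊆ˢ E M₀ w u
  added⊆E {c} {b} {S} fresh acc s = [ (λ cbs → contradiction cbs (fresh s)) , acc s ]′ ∘ addSkills-self⁻ {c} {b} {S}

  ⊆E⇒accessible : ∀ {c b S w u} → addSkills c b S b ⊆ˢ E M₀ w u → Accessible S w u
  ⊆E⇒accessible {c} {b} {S} inc s s∈S = inc s (addSkills-self⁺ {c} {b} {S} (inj₂ s∈S))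

  K-elim : ∀ {c b S w u φ} → Fresh c b → Accessible S w u →
           M[ addSkills c b S ] , w ⊨ K b φ → M[ addSkills c b S ] , u ⊨ φ
  K-elim {c} {b} {S} fresh acc ⊨Kφ = ⊨Kφ _ (added⊆E {c} {b} {S} fresh acc)

  K-intro : ∀ {c b S w u φ} → S ≢ [] → Accessible S w u →
            M[ addSkills c b S ] , u ⊨ φ → M[ addSkills c b S ] , w ⊨ K b φ
  K-intro {c} {b} {S} {φ = φ} S≢[] acc ⊨φ u′ inc =
    subst (λ v → M[ addSkills c b S ] , v ⊨ φ) (accessible-unique S≢[] acc (⊆E⇒accessible {c} {b} {S} inc)) ⊨φ

  accessible⇒⊨ψ : ∀ {c i S w u} → Fresh c (a i) → S ≢ [] → Accessible S w u → M[ addSkills c (a i) S ] , w ⊨ ψ i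
  accessible⇒⊨ψ {c} {i} {S} {w} {u} fresh S≢[] acc =
    (λ ⊨K⊥ → K-elim {c} {a i} {S} {φ = ⊥'} fresh acc ⊨K⊥ id) ,
    ⊨⋁⁺ {M[ addSkills c (a i) S ]} {w}
        (map⁺ {f = λ x → K (a i) (p x)} (lose (∈-allFin u) (K-intro {c} {a i} {S} S≢[] acc refl)))

  inaccessible⇒⊭ψ : ∀ {c i S w} → (∀ u → ¬ Accessible S w u) → ¬ (M[ addSkills c (a i) S ] , w ⊨ ψ i)
  inaccessible⇒⊭ψ {c} {i} {S} noAcc (⊭K⊥ , _) =
    ⊭K⊥ λ u inc → contradiction (⊆E⇒accessible {c} {a i} {S} inc) (noAcc u)

  -- The pieces of Induced.χ, so that the list lemmas can be instantiated with them.
  χ-disjunct : ℕ → Fin k → Fin k → ℕ → Form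
  χ-disjunct i x y j = p x ∧' K̂ (a j) (p y) ∧' K (a i) (p y)

  χ-disjuncts : ℕ → Fin k → Fin k → List Form
  χ-disjuncts i x y = if x == y then [] else map (χ-disjunct i x y) (map suc (upTo (i ∸ 1)))

  χ-intro : ∀ {M w i x y j} → x ≢ y → 1 ≤ j → j < i → M , w ⊨ χ-disjunct i x y j → M , w ⊨ χ i
  χ-intro {x = x} {y} x≢y (s≤s z≤n) (s≤s j<i) ⊨D =
    ⊨⋁⁺ (concatMap⁺ _ (lose (∈-allFin x) (concatMap⁺ _ (lose (∈-allFin y)
      (Any-unless⁺ (dec-false (x F.≟ y) x≢y) (map⁺ (map⁺ (lose (∈-upTo⁺ j<i) ⊨D))))))))

  χ-elim : ∀ {M w i} → M , w ⊨ χ i → ∃ λ x → ∃ λ y → ∃ λ j → 1 ≤ j × j < i × M , w ⊨ χ-disjunct i x y j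
  χ-elim {M} {w} {i} ⊨χ =
    let x , ⊨χx     = satisfied (concatMap⁻ (λ x → concatMap (χ-disjuncts i x) (allFin k)) {xs = allFin k} (⊨⋁⁻ {M} {w} _ ⊨χ))
        y , ⊨χxy    = satisfied (concatMap⁻ (χ-disjuncts i x) {xs = allFin k} ⊨χx)
        j , j∈ , ⊨D = find (map⁻ {f = suc} (map⁻ {f = χ-disjunct i x y} (Any-unless⁻ (x == y) ⊨χxy)))
    in x , y , suc j , s≤s z≤n , <∸1⇒suc< i (∈-upTo⁻ j∈) , ⊨D

  agent-<-≢ : ∀ {j i} → 1 ≤ j → j < i → i ≤ n → a j ≢ a i
  agent-<-≢ 1≤j j<i i≤n aj≡ai =
    <-irrefl (agent-inj ag _ _ 1≤j (≤-trans (<⇒≤ j<i) i≤n) (≤-trans 1≤j (<⇒≤ j<i)) i≤n aj≡ai) j<i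

  -- The edge {x,y} was played in round j < i: agent a_j was given exactly its skill.
  Recorded : (ℕ → SkillSet) → ℕ → Fin k → Fin k → Set
  Recorded c i x y = ∃ λ j → 1 ≤ j × j < i × c (a j) ⊆ˢ E M₀ x y

  -- Before round i: r holds the unplayed edges and a_i, …, a_n are still without skills.
  record Invariant (c : ℕ → SkillSet) (r : Edges k) (i : ℕ) : Set where
    field
      simple           : Simple r
      ⊆adj             : ∀ {x y} → r x y ≡ true → adj G x y ≡ true
      1≤i              : 1 ≤ i
      i≤n              : i ≤ n
      fresh            : ∀ {m} → i ≤ m → m ≤ n → Fresh c (a m)
      removed⇒recorded : ∀ {x y} → adj G x y ≡ true → r x y ≡ false → Recorded c i x y
      recorded⇒removed : ∀ {x y} → Recorded c i x y → r x y ≡ false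

    fresh-here : Fresh c (a i)
    fresh-here = fresh ≤-refl i≤n

  open Invariant using (simple; ⊆adj; fresh-here)

  initial : 1 ≤ n → Invariant (λ _ _ → ⊥) (adj G) 1
  initial 1≤n = record
    { simple           = adj-simple
    ; ⊆adj             = id
    ; 1≤i              = ≤-refl
    ; i≤n              = 1≤n
    ; fresh            = λ _ _ _ ()
    ; removed⇒recorded = λ axy axy≡false → contradiction (trans (sym axy) axy≡false) λ ()
    ; recorded⇒removed = λ { (j , 1≤j , j<1 , _) → contradiction (≤-trans 1≤j (≤-pred j<1)) λ () }
    }

  invariant-step : ∀ {c r i S w u} → Invariant c r i → i < n → S ≢ [] → Accessible S w u →
                   Invariant (addSkills c (a i) S) (removeEdge r w u) (suc i)
  invariant-step {c} {r} {i} {S} {w} {u} inv i<n S≢[] acc = record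
    { simple           = removeEdge-simple (simple inv)
    ; ⊆adj             = ⊆adj inv ∘ removeEdge-⊆ {r = r}
    ; 1≤i              = s≤s z≤n
    ; i≤n              = i<n
    ; fresh            = λ {m} i<m m≤n s → Invariant.fresh inv (<⇒≤ i<m) m≤n s
                           ∘ addSkills-other⁻ {c} {a i} {S} (≢-sym (agent-<-≢ (Invariant.1≤i inv) i<m m≤n))
    ; removed⇒recorded = removed⇒recorded
    ; recorded⇒removed = recorded⇒removed
    }
    where
    earlier≢ : ∀ {j} → 1 ≤ j → j < i → a j ≢ a i
    earlier≢ 1≤j j<i = agent-<-≢ 1≤j j<i (<⇒≤ i<n)

    removed⇒recorded : ∀ {x y} → adj G x y ≡ true → removeEdge r w u x y ≡ false →
                       Recorded (addSkills c (a i) S) (suc i) x y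
    removed⇒recorded axy r′xy with removeEdge-false {r = r} r′xy
    ... | inj₁ rxy  = let j , 1≤j , j<i , cj⊆E = Invariant.removed⇒recorded inv axy rxy
                      in j , 1≤j , m<n⇒m<1+n j<i , λ s → cj⊆E s ∘ addSkills-other⁻ {c} {a i} {S} (earlier≢ 1≤j j<i)
    ... | inj₂ same = i , Invariant.1≤i inv , n<1+n i , λ s → E-same same ∘ added⊆E {c} {a i} {S} (fresh-here inv) acc s

    recorded⇒removed : ∀ {x y} → Recorded (addSkills c (a i) S) (suc i) x y → removeEdge r w u x y ≡ false
    recorded⇒removed (j , 1≤j , j<1+i , c′j⊆E) with m<1+n⇒m<n∨m≡n j<1+i
    ... | inj₁ j<i  = removeEdge-absent {r = r} (Invariant.recorded⇒removed inv
                        (j , 1≤j , j<i , λ s → c′j⊆E s ∘ addSkills-other⁺ {c} {a i} {S} (earlier≢ 1≤j j<i)))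
    ... | inj₂ refl = let s , s∈S = ≢[]⇒∃∈ S≢[] in removeEdge-removed {r = r}
                        (E-skill-injective (c′j⊆E s (addSkills-self⁺ {c} {a i} {S} (inj₂ s∈S))) (acc s s∈S))

  used-edge⇒⊨χ : ∀ {c r i S w u} → Invariant c r i → S ≢ [] → Accessible S w u → r w u ≡ false →
                 M[ addSkills c (a i) S ] , w ⊨ χ i
  used-edge⇒⊨χ {c} {r} {i} {S} {w} {u} inv S≢[] acc rwu =
    let awu                  = accessible⇒adj S≢[] acc
        j , 1≤j , j<i , cj⊆E = Invariant.removed⇒recorded inv awu rwu
        aj≢ai                = agent-<-≢ 1≤j j<i (Invariant.i≤n inv)
    in χ-intro (adj⇒≢ awu) 1≤j j<i
         ( refl
         , (λ ⊨K¬u → ⊨K¬u u (λ s → cj⊆E s ∘ addSkills-other⁻ {c} {a i} {S} aj≢ai) refl)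
         , K-intro {c} {a i} {S} S≢[] acc refl )

  unused-edge⇒⊭χ : ∀ {c r i S w u} → Invariant c r i → Accessible S w u → r w u ≡ true →
                   ¬ (M[ addSkills c (a i) S ] , w ⊨ χ i)
  unused-edge⇒⊭χ {c} {r} {i} {S} {w} {u} inv acc rwu ⊨χ =
    let x , y , j , 1≤j , j<i , _ , ⊨K̂y , ⊨Ky = χ-elim ⊨χ
        aj≢ai = agent-<-≢ 1≤j j<i (Invariant.i≤n inv)
        y≡u   = atomOf-inj at y u (⊨Ky u (added⊆E {c} {a i} {S} (fresh-here inv) acc))
    in ⊨K̂y λ u′ inc y≡u′ →
         let rwu′ = Invariant.recorded⇒removed inv
                      (j , 1≤j , j<i , λ s → inc s ∘ addSkills-other⁺ {c} {a i} {S} aj≢ai)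
             u′≡u = trans (sym (atomOf-inj at y u′ y≡u′)) y≡u
         in contradiction (trans (sym rwu) (subst (λ v → r w v ≡ false) u′≡u rwu′)) λ ()

  unused-edge⇒⊨ψ∧⊭χ : ∀ {c r i w u} → Invariant c r i → r w u ≡ true →
                      M[ addSkills c (a i) [ skill sk w u ] ] , w ⊨ ψ i
                      × ¬ (M[ addSkills c (a i) [ skill sk w u ] ] , w ⊨ χ i)
  unused-edge⇒⊨ψ∧⊭χ {w = w} {u} inv rwu =
    accessible⇒⊨ψ (fresh-here inv) (λ ()) acc , unused-edge⇒⊭χ inv acc rwu
    where
    acc : Accessible [ skill sk w u ] w u
    acc = single-accessible (⊆adj inv rwu)

  turn-cases : ∀ {c r i S} → Invariant c r i → ∀ w → S ≢ [] →
               ¬ (M[ addSkills c (a i) S ] , w ⊨ ψ i) ⊎ (M[ addSkills c (a i) S ] , w ⊨ χ i)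
               ⊎ ∃ λ u → Accessible S w u × r w u ≡ true
  turn-cases {c} {r} {i} {S} inv w S≢[] with any? (accessible? S w)
  ... | no noAcc = inj₁ (inaccessible⇒⊭ψ {c} {i} (λ u acc → noAcc (u , acc)))
  ... | yes (u , acc) with r w u in rwu
  ...   | false = inj₂ (inj₁ (used-edge⇒⊨χ inv S≢[] acc rwu))
  ...   | true  = inj₂ (inj₂ (u , acc , rwu))

  Move : ℕ → Form → Form
  Move i Φ = ⟨⊞⟩ (a i) (ψ i ∧' ¬' χ i ∧' K (a i) Φ)

  Reply : ℕ → Form → Form
  Reply j X = ⊞ (a j) (¬' ψ j ∨' χ j ∨' X)

  LastReply : ℕ → Form
  LastReply j = ⊞ (a j) (¬' ψ j ∨' χ j)

  ⊨Move : ∀ {c r i w u Φ} → Invariant c r i → i < n → r w u ≡ true →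
              (Invariant (addSkills c (a i) [ skill sk w u ]) (removeEdge r w u) (suc i) →
               M[ addSkills c (a i) [ skill sk w u ] ] , u ⊨ Φ) →
              M[ c ] , w ⊨ Move i Φ
  ⊨Move {c} {r} {i} {w} {u} {Φ} inv i<n rwu continue everyChoiceFails =
    let ⊨ψ , ⊭χ = unused-edge⇒⊨ψ∧⊭χ inv rwu
    in everyChoiceFails [ skill sk w u ] (λ ())
         (⊨ψ , ⊭χ , K-intro {c} {a i} {φ = Φ} (λ ()) acc (continue (invariant-step inv i<n (λ ()) acc)))
    where
    acc : Accessible [ skill sk w u ] w u
    acc = single-accessible (⊆adj inv rwu)

  ⊭Move : ∀ {c r i w Φ} → Invariant c r i → i < n →
              (∀ {S} u → r w u ≡ true → Invariant (addSkills c (a i) S) (removeEdge r w u) (suc i) →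
               ¬ (M[ addSkills c (a i) S ] , u ⊨ Φ)) →
              ¬ (M[ c ] , w ⊨ Move i Φ)
  ⊭Move {c} {r} {i} {w} {Φ} inv i<n refute ⊨move = ⊨move λ S S≢[] (⊨ψ , ⊭χ , ⊨KΦ) →
    case turn-cases inv w S≢[] of λ where
      (inj₁ ⊭ψ)                 → ⊭ψ ⊨ψ
      (inj₂ (inj₁ ⊨χ))          → ⊭χ ⊨χ
      (inj₂ (inj₂ (u , acc , rwu))) →
        refute u rwu (invariant-step inv i<n S≢[] acc) (K-elim {c} {a i} {S} {φ = Φ} (fresh-here inv) acc ⊨KΦ)

  ⊨Reply : ∀ {c r j u X} → Invariant c r j → j < n →
             (∀ {S} v → Accessible S u v → r u v ≡ true → Invariant (addSkills c (a j) S) (removeEdge r u v) (suc j) →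
              M[ addSkills c (a j) S ] , u ⊨ X) →
             M[ c ] , u ⊨ Reply j X
  ⊨Reply {u = u} inv j<n continue S S≢[] =
    map₂ (map₂ λ (v , acc , ruv) → continue v acc ruv (invariant-step inv j<n S≢[] acc)) (turn-cases inv u S≢[])

  ⊭Reply : ∀ {c r j u v X} → Invariant c r j → j < n → r u v ≡ true →
             (Invariant (addSkills c (a j) [ skill sk u v ]) (removeEdge r u v) (suc j) →
              ¬ (M[ addSkills c (a j) [ skill sk u v ] ] , u ⊨ X)) →
             ¬ (M[ c ] , u ⊨ Reply j X)
  ⊭Reply {u = u} {v} inv j<n ruv refute ⊨reply =
    let ⊨ψ , ⊭χ = unused-edge⇒⊨ψ∧⊭χ inv ruv
    in [ (λ ⊭ψ → ⊭ψ ⊨ψ) , [ ⊭χ , refute (invariant-step inv j<n (λ ()) (single-accessible (⊆adj inv ruv))) ]′ ]′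
         (⊨reply [ skill sk u v ] (λ ()))

  ⊨LastReply : ∀ {c r j u} → Invariant c r j → (∀ v → r u v ≢ true) → M[ c ] , u ⊨ LastReply j
  ⊨LastReply {u = u} inv noMove S S≢[] =
    [ inj₁ , [ inj₂ , (λ (v , _ , ruv) → contradiction ruv (noMove v)) ]′ ]′ (turn-cases inv u S≢[])

  ⊭LastReply : ∀ {c r j u v} → Invariant c r j → r u v ≡ true → ¬ (M[ c ] , u ⊨ LastReply j)
  ⊭LastReply {u = u} {v} inv ruv ⊨reply =
    let ⊨ψ , ⊭χ = unused-edge⇒⊨ψ∧⊭χ inv ruv
    in [ (λ ⊭ψ → ⊭ψ ⊨ψ) , ⊭χ ]′ (⊨reply [ skill sk u v ] (λ ()))

  wins⇒⊨Θ : ∀ t {c r i w} → Invariant c r i → i + double t < n → edges r ≤ double (suc t) → Wins r w →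
            M[ c ] , w ⊨ Θaux t i
  wins⇒⊨Θ zero {i = i} inv bound edges≤2 (move u rwu (stuck replies)) =
    ⊨Move {Φ = LastReply (suc i)} inv (m+n≤o⇒m≤o (suc i) bound) rwu λ inv′ →
      ⊨LastReply inv′ λ v r′uv → no-third-move (simple inv) rwu r′uv edges≤2 (replies v r′uv)
  wins⇒⊨Θ (suc t) {r = r} {i} {w} inv bound edges≤ (move u rwu (stuck replies)) =
    ⊨Move {Φ = Reply (suc i) (K̂ (a (suc i)) (Θaux t (2 + i)))} inv (<⇒≤ 1+i<n) rwu λ inv′ →
      ⊨Reply {X = K̂ (a (suc i)) (Θaux t (2 + i))} inv′ 1+i<n λ v acc r′uv inv″ ⊨K¬Θ →
        K-elim {b = a (suc i)} {φ = ¬' Θaux t (2 + i)} (fresh-here inv′) acc ⊨K¬Θ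
          (wins⇒⊨Θ t inv″ bound′ (edges≤′ r′uv) (replies v r′uv))
    where
    1+i<n : suc i < n
    1+i<n = proj₁ (round-bounds bound)
    bound′ : suc (suc i) + double t < n
    bound′ = proj₂ (round-bounds bound)

    edges≤′ : ∀ {v} → removeEdge r w u u v ≡ true → edges (removeEdge (removeEdge r w u) u v) ≤ double (suc t)
    edges≤′ r′uv = ≤-pred (≤-pred (≤-trans (edges-two-moves (simple inv) rwu r′uv) edges≤))

  loses⇒⊭Θ : ∀ t {c r i w} → Invariant c r i → i + double t < n → Loses r w → ¬ (M[ c ] , w ⊨ Θaux t i)
  loses⇒⊭Θ zero {i = i} inv bound (stuck replies) =
    ⊭Move {Φ = LastReply (suc i)} inv (m+n≤o⇒m≤o (suc i) bound) λ u rwu inv′ →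
      case replies u rwu of λ where
        (move v r′uv _) → ⊭LastReply inv′ r′uv
  loses⇒⊭Θ (suc t) {i = i} inv bound (stuck replies) =
    ⊭Move {Φ = Reply (suc i) (K̂ (a (suc i)) (Θaux t (2 + i)))} inv (<⇒≤ 1+i<n) λ u rwu inv′ →
      case replies u rwu of λ where
        (move v r′uv loses) → ⊭Reply {X = K̂ (a (suc i)) (Θaux t (2 + i))} inv′ 1+i<n r′uv λ inv″ ⊨K̂Θ →
          ⊨K̂Θ (K-intro {b = a (suc i)} {φ = ¬' Θaux t (2 + i)} (λ ()) (single-accessible (⊆adj inv′ r′uv))
                        (loses⇒⊭Θ t inv″ bound′ loses))
    where
    1+i<n : suc i < n
    1+i<n = proj₁ (round-bounds bound)
    bound′ : suc (suc i) + double t < n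
    bound′ = proj₂ (round-bounds bound)

lemma13 : ∀ {k : ℕ} (G : Graph k) (d : Fin k)
            (sk : SkillAssignment G) (at : AtomAssignment k) (ag : AgentAssignment (nG G)) →
            PlayerIWins G d ⇔ (M_G G d sk at , d ⊨ φ_G G at ag)
lemma13 G d sk at ag =
  mk⇔ (wins⇒⊨Θ q (initial 1≤n) bound edges≤)
      (λ ⊨φ → [ id , (λ loses → contradiction ⊨φ (loses⇒⊭Θ q (initial 1≤n) bound loses)) ]′
                 (determined (edges (adj G)) adj-simple ≤-refl d))
  where
  open Play G d sk at ag
  open Induced G at ag using (n)

  q : ℕ
  q = ⌊ (n ∸ 2) /2⌋

  n≡ : n ≡ double (suc q)
  n≡ = posEvenCeil≡double (edgeCount G)

  bound : 1 + double q < n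
  bound = ≤-reflexive (sym n≡)

  1≤n : 1 ≤ n
  1≤n = ≤-trans (s≤s z≤n) bound

  edges≤ : edges (adj G) ≤ double (suc q)
  edges≤ = subst (edges (adj G) ≤_) n≡ (≤posEvenCeil (edgeCount G))
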